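{- Let $G$ be a $3$-chromatic Eulerian triangulation of a closed surface. If $c_{4,2}(G)=0$, i.e. every vertex of $G$ has degree divisible by $4$, then Bob wins the feedback game on $G$ for every choice of starting vertex.
   Context: All graphs are finite, simple and undirected. A graph is Eulerian if every vertex has even degree. A triangulation of a closed surface (compact 2-manifold without boundary) is a graph embedded on the surface such that every face is a triangle and any two faces share at most one edge. $c_{n,k}(G)$ denotes the number of vertices of $G$ whose degree is congruent to $k$ modulo $n$. The feedback game on a connected graph $G$ with a starting vertex $s$: a token is placed on $s$; two players, Alice (who moves first) and Bob, alternately move the token from its current vertex $u$ to a vertex $v$ adjacent to $u$, and the edge $uv$ is then deleted. The first player who moves the token back to $s$, or to a vertex that is isolated after deletion of the edge just used, wins. "X wins the game" means X has a winning strategy. -}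

module Defs where

open import Data.Nat using (ℕ; _+_)
open import Data.Nat.Divisibility using (_∣_)
open import Data.Fin using (Fin; _≟_)
open import Data.Bool using (Bool; true; false; if_then_else_; _∧_; _∨_)
open import Data.List using (List; map; allFin)
open import Data.Nat.ListAction using (sum)
open import Data.Product using (_×_)
open import Data.Sum using (_⊎_)
open import Relation.Nullary using (¬_)
open import Relation.Nullary.Decidable using (⌊_⌋)
open import Relation.Binary.PropositionalEquality using (_≡_; _≢_)
open import Relation.Binary.Construct.Closure.ReflexiveTransitive using (Star)

record Graph (n : ℕ) : Set where
  field
    adj   : Fin n → Fin n → Bool
    sym   : ∀ u v → adj u v ≡ adj v u
    irrefl : ∀ v → adj v v ≡ false
open Graph public

count : ∀ {n} → (Fin n → Bool) → ℕ
count {n} f = sum (map (λ w → if f w then 1 else 0) (allFin n))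

deg : ∀ {n} → Graph n → Fin n → ℕ
deg G v = count (adj G v)

Connected : ∀ {n} → Graph n → Set
Connected G = ∀ u w → Star (λ a b → adj G a b ≡ true) u w

Colourable : ∀ {n} → ℕ → Graph n → Set
Colourable {n} k G = Data.Product.Σ (Fin n → Fin k)
  (λ c → ∀ u v → adj G u v ≡ true → c u ≢ c v)

ThreeChromatic : ∀ {n} → Graph n → Set
ThreeChromatic G = Colourable 3 G × ¬ Colourable 2 G

Eulerian : ∀ {n} → Graph n → Set
Eulerian G = ∀ v → 2 ∣ deg G v

-- Triangulation of a closed (connected) surface, in combinatorial form:
-- a set of triangular faces (unordered triples of mutually adjacent vertices,
-- given by a symmetric indicator), every edge in exactly two faces, the link of
-- every vertex connected (hence a single cycle), and the graph connected.
-- Faces are distinct vertex triples, so two faces share at most one edge.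
record Triangulation {n : ℕ} (G : Graph n) : Set where
  field
    face    : Fin n → Fin n → Fin n → Bool
    face-sym₁ : ∀ a b c → face a b c ≡ face b a c
    face-sym₂ : ∀ a b c → face a b c ≡ face a c b
    face-adj  : ∀ a b c → face a b c ≡ true →
                adj G a b ≡ true × adj G b c ≡ true × adj G a c ≡ true
    edge-two  : ∀ u v → adj G u v ≡ true → count (face u v) ≡ 2
    link-connected : ∀ v u w → adj G v u ≡ true → adj G v w ≡ true →
                Star (λ a b → face v a b ≡ true) u w
    connected : Connected G

del : ∀ {n} → (Fin n → Fin n → Bool) → Fin n → Fin n → Fin n → Fin n → Bool
del E u v a b =
  if (⌊ a ≟ u ⌋ ∧ ⌊ b ≟ v ⌋) ∨ (⌊ a ≟ v ⌋ ∧ ⌊ b ≟ u ⌋) then false else E a b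

-- The feedback game with start vertex s.  A position is (remaining edges E,
-- token vertex u); Win/Lose are from the viewpoint of the player to move.
module Game {n : ℕ} (s : Fin n) where

  Isolated : (Fin n → Fin n → Bool) → Fin n → Set
  Isolated E v = ∀ w → E v w ≡ false

  Ends : (Fin n → Fin n → Bool) → Fin n → Set
  Ends E v = v ≡ s ⊎ Isolated E v

  data Win (E : Fin n → Fin n → Bool) (u : Fin n) : Set
  data Lose (E : Fin n → Fin n → Bool) (u : Fin n) : Set

  data Win E u where
    winNow   : ∀ v → E u v ≡ true → Ends (del E u v) v → Win E u
    winLater : ∀ v → E u v ≡ true → Lose (del E u v) v → Win E u

  data Lose E u where
    lose : (∀ v → E u v ≡ true → ¬ Ends (del E u v) v × Win (del E u v) v) →
           Lose E u

BobWins : ∀ {n} → Graph n → Fin n → Set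
BobWins G s = Game.Lose s (adj G) s

module Submission where

-- Fix a proper 3-colouring c of G and let S be
-- the colour class of the start vertex s.  Call a set E of remaining edges
-- balanced when it is symmetric, no edge of E joins two vertices of S, and
-- every vertex outside S has an even number of E-edges into S.
--
-- If E is balanced and the token is on a vertex u ∈ S with
--     Alice to move, then Bob wins: Alice must move to some v ∉ S (so v ≠ s);
--     deleting uv leaves v an odd, hence positive, number of edges into S, so
--     v is not isolated and Bob can answer with an edge vw, w ∈ S.  The two
--     deletions lower the S-degree of v by 2 and change no other S-degree
--     outside S, so the position is again balanced.  Induction on the number
--     of remaining edges finishes the argument.
-- (2) Triangulation lemma.  At a vertex y ∉ S every face y a b has exactly one
--     corner a or b in S; double counting the faces at y (each edge lies in
--     exactly two faces) shows that y has as many neighbours in S as outside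
--     S.  Thus deg y = 2·(S-degree of y), and 4 ∣ deg y makes it even.
-- The theorem applies (1) to E = all edges of G, which is balanced by (2).

open import Defs hiding (sym)
open import Data.Nat using (ℕ; zero; suc; _+_; _*_; _≤_; _<_; z≤n)
open import Data.Nat.Properties
  using (+-comm; +-assoc; +-identityʳ; *-assoc; *-cancelˡ-≡; ≤-refl; +-mono-≤;
         +-mono-<-≤; +-mono-≤-<; <-≤-trans; <⇒≤; ≤-reflexive; +-*-semiring)
open import Data.Nat.Divisibility using (_∣_; *-cancelˡ-∣; ∣m+n∣m⇒∣n; ∣-refl; ∣1⇒≡1)
open import Data.Nat.Induction using (<-wellFounded)
open import Data.Nat.ListAction as List using ()
open import Data.Fin using (Fin; zero; suc; _≟_; punchOut)
open import Data.Fin.Properties using (suc-injective; punchOut-injective)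
open import Data.Bool using (Bool; true; false; if_then_else_; _∧_; _∨_; not)
open import Data.Bool.Properties using (∧-comm; ∨-comm)
open import Data.List using (tabulate)
open import Data.List.Properties using (map-tabulate)
open import Data.Product using (Σ; _×_; _,_; proj₁; proj₂)
open import Data.Sum using (_⊎_; inj₁; inj₂)
open import Data.Empty using (⊥-elim)
open import Function using (_∘_)
open import Induction.WellFounded using (Acc; acc)
open import Relation.Nullary using (¬_; Dec; yes; no)
open import Relation.Nullary.Decidable using (⌊_⌋)
open import Relation.Binary.PropositionalEquality
  using (_≡_; _≢_; refl; sym; trans; cong; cong₂; subst; module ≡-Reasoning)
open import Algebra.Properties.Semiring.Sum +-*-semiring
  using (sum; sum-syntax; sum-cong-≗; sum-replicate-zero; ∑-distrib-+; ∑-comm;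
         *-distribˡ-sum; *-distribʳ-sum)

yes⇒⌊⌋ : ∀ {P : Set} (p : Dec P) → P → ⌊ p ⌋ ≡ true
yes⇒⌊⌋ (yes _) _ = refl
yes⇒⌊⌋ (no ¬x) x = ⊥-elim (¬x x)

no⇒⌊⌋ : ∀ {P : Set} (p : Dec P) → ¬ P → ⌊ p ⌋ ≡ false
no⇒⌊⌋ (yes x) ¬x = ⊥-elim (¬x x)
no⇒⌊⌋ (no _) _ = refl

⌊⌋⇒yes : ∀ {P : Set} (p : Dec P) → ⌊ p ⌋ ≡ true → P
⌊⌋⇒yes (yes x) _ = x

⌊⌋⇒no : ∀ {P : Set} (p : Dec P) → ⌊ p ⌋ ≡ false → ¬ P
⌊⌋⇒no (no ¬x) _ = ¬x

⌊⌋-∧-false : ∀ {P Q : Set} (p : Dec P) (q : Dec Q) → ¬ (P × Q) → ⌊ p ⌋ ∧ ⌊ q ⌋ ≡ false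
⌊⌋-∧-false (yes x) (yes y) ¬xy = ⊥-elim (¬xy (x , y))
⌊⌋-∧-false (yes _) (no _) _ = refl
⌊⌋-∧-false (no _) _ _ = refl

∧-true : ∀ {x y} → x ∧ y ≡ true → x ≡ true × y ≡ true
∧-true {true} {true} _ = refl , refl

odd-nonzero : ∀ m → 2 ∣ m + 1 → m ≢ 0
odd-nonzero m 2∣1 refl with ∣1⇒≡1 2∣1
... | ()

even-minus-two : ∀ m → 2 ∣ m + 1 + 1 → 2 ∣ m
even-minus-two m 2∣m+2 = ∣m+n∣m⇒∣n (subst (2 ∣_) (trans (+-assoc m 1 1) (+-comm m 2)) 2∣m+2) ∣-refl

-- Counting.  card f is the number of a : Fin n with f a = true, written as a
-- semiring sum of indicators so that the library's summation laws apply.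

ind : Bool → ℕ
ind b = if b then 1 else 0

ind-∧ : ∀ x y → ind (x ∧ y) ≡ ind x * ind y
ind-∧ true true = refl
ind-∧ true false = refl
ind-∧ false _ = refl

card : ∀ {n} → (Fin n → Bool) → ℕ
card {n} f = ∑[ a < n ] ind (f a)

count≡card : ∀ {n} (f : Fin n → Bool) → count f ≡ card f
count≡card {n} f = trans (cong List.sum (map-tabulate (λ a → a) (ind ∘ f))) (list-sum (ind ∘ f))
  where
  list-sum : ∀ {m} (h : Fin m → ℕ) → List.sum (tabulate h) ≡ sum h
  list-sum {zero} h = refl
  list-sum {suc m} h = cong (h zero +_) (list-sum (h ∘ suc))

card-cong : ∀ {n} {f g : Fin n → Bool} → (∀ a → f a ≡ g a) → card f ≡ card g
card-cong f≗g = sum-cong-≗ (cong ind ∘ f≗g)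

card-empty : ∀ {n} (f : Fin n → Bool) → (∀ a → f a ≡ false) → card f ≡ 0
card-empty {n} f none = trans (card-cong none) (sum-replicate-zero n)

card-witness : ∀ {n} (f : Fin n → Bool) → card f ≢ 0 → Σ (Fin n) λ a → f a ≡ true
card-witness {zero} f pos = ⊥-elim (pos refl)
card-witness {suc n} f pos with f zero in f0
... | true = zero , f0
... | false with card-witness (f ∘ suc) pos
...   | a , fa = suc a , fa

card-split : ∀ {n} (f P : Fin n → Bool) →
  card f ≡ card (λ a → f a ∧ P a) + card (λ a → f a ∧ not (P a))
card-split f P = trans (sum-cong-≗ (λ a → split (f a) (P a)))
                       (∑-distrib-+ (λ a → ind (f a ∧ P a)) (λ a → ind (f a ∧ not (P a))))
  where
  split : ∀ x y → ind x ≡ ind (x ∧ y) + ind (x ∧ not y)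
  split true true = refl
  split true false = refl
  split false _ = refl

card-∧-const : ∀ {n} (f : Fin n → Bool) x → card (λ b → f b ∧ x) ≡ card f * ind x
card-∧-const f x = trans (sum-cong-≗ (λ b → ind-∧ (f b) x)) (sym (*-distribʳ-sum (ind x) (ind ∘ f)))

card-remove : ∀ {n} (f g : Fin n → Bool) (p : Fin n) → f p ≡ true → g p ≡ false →
  (∀ a → a ≢ p → g a ≡ f a) → card g + 1 ≡ card f
card-remove f g zero fp gp g≡f
  rewrite fp | gp | card-cong (λ a → g≡f (suc a) λ ()) = +-comm (card (f ∘ suc)) 1
card-remove f g (suc p) fp gp g≡f rewrite g≡f zero (λ ()) =
  trans (+-assoc (ind (f zero)) (card (g ∘ suc)) 1)
        (cong (ind (f zero) +_)
              (card-remove (f ∘ suc) (g ∘ suc) p fp gp (λ a a≢p → g≡f (suc a) (a≢p ∘ suc-injective))))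

card-mono : ∀ {n} (f g : Fin n → Bool) → (∀ a → g a ≡ true → f a ≡ true) → card g ≤ card f
card-mono {zero} f g g⊆f = z≤n
card-mono {suc n} f g g⊆f =
  +-mono-≤ (ind-mono (g zero) (f zero) (g⊆f zero)) (card-mono (f ∘ suc) (g ∘ suc) (g⊆f ∘ suc))
  where
  ind-mono : ∀ x y → (x ≡ true → y ≡ true) → ind x ≤ ind y
  ind-mono false _ _ = z≤n
  ind-mono true y x⇒y rewrite x⇒y refl = ≤-refl

∑-mono-< : ∀ {n} (f g : Fin n → ℕ) (p : Fin n) → (∀ a → g a ≤ f a) → g p < f p → sum g < sum f
∑-mono-< f g zero g≤f gp<fp = +-mono-<-≤ gp<fp (∑-mono (f ∘ suc) (g ∘ suc) (g≤f ∘ suc))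
  where
  ∑-mono : ∀ {m} (f g : Fin m → ℕ) → (∀ a → g a ≤ f a) → sum g ≤ sum f
  ∑-mono {zero} _ _ _ = z≤n
  ∑-mono {suc m} f g g≤f = +-mono-≤ (g≤f zero) (∑-mono (f ∘ suc) (g ∘ suc) (g≤f ∘ suc))
∑-mono-< f g (suc p) g≤f gp<fp = +-mono-≤-< (g≤f zero) (∑-mono-< (f ∘ suc) (g ∘ suc) p (g≤f ∘ suc) gp<fp)

Edges : ℕ → Set
Edges n = Fin n → Fin n → Bool

-- Number of (ordered) pairs in an edge set: the measure for the game induction.
size : ∀ {n} → Edges n → ℕ
size {n} E = ∑[ a < n ] card (E a)

module Deletion {n : ℕ} (E : Edges n) (u v : Fin n) where

  del-⊆ : ∀ a b → del E u v a b ≡ true → E a b ≡ true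
  del-⊆ a b with (⌊ a ≟ u ⌋ ∧ ⌊ b ≟ v ⌋) ∨ (⌊ a ≟ v ⌋ ∧ ⌊ b ≟ u ⌋)
  ... | true = λ ()
  ... | false = λ Eab → Eab

  del-comm : ∀ a b → del E u v a b ≡ del E v u a b
  del-comm a b = cong (λ t → if t then false else E a b) (∨-comm (⌊ a ≟ u ⌋ ∧ ⌊ b ≟ v ⌋) _)

  del-symmetric : (∀ a b → E a b ≡ E b a) → ∀ a b → del E u v a b ≡ del E u v b a
  del-symmetric E-sym a b rewrite ∧-comm ⌊ b ≟ u ⌋ ⌊ a ≟ v ⌋ | ∧-comm ⌊ b ≟ v ⌋ ⌊ a ≟ u ⌋
    | ∨-comm (⌊ a ≟ v ⌋ ∧ ⌊ b ≟ u ⌋) (⌊ a ≟ u ⌋ ∧ ⌊ b ≟ v ⌋) | E-sym a b = refl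

  del-keeps : ∀ a b → ¬ (a ≡ u × b ≡ v) → ¬ (a ≡ v × b ≡ u) → del E u v a b ≡ E a b
  del-keeps a b not-uv not-vu
    rewrite ⌊⌋-∧-false (a ≟ u) (b ≟ v) not-uv | ⌊⌋-∧-false (a ≟ v) (b ≟ u) not-vu = refl

  del-removes : del E u v u v ≡ false
  del-removes rewrite yes⇒⌊⌋ (u ≟ u) refl | yes⇒⌊⌋ (v ≟ v) refl = refl

  del-row : ∀ x → x ≢ v → del E u v u x ≡ E u x
  del-row x x≢v = del-keeps u x (λ (_ , x≡v) → x≢v x≡v) (λ (u≡v , x≡u) → x≢v (trans x≡u u≡v))

  size-del : E u v ≡ true → size (del E u v) < size E
  size-del Euv = ∑-mono-< (card ∘ E) (card ∘ del E u v) u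
    (λ a → card-mono (E a) (del E u v a) (del-⊆ a))
    (≤-reflexive (trans (+-comm 1 _) (card-remove (E u) (del E u v u) v Euv del-removes del-row)))

open Deletion

module BalancedGame {n : ℕ} (s : Fin n) (S : Fin n → Bool) (s∈S : S s ≡ true) where
  open Game s

  degS : Edges n → Fin n → ℕ
  degS E y = card (λ w → E y w ∧ S w)

  -- The invariant Bob maintains (positions with the token in S, Alice to move).
  record Balanced (E : Edges n) : Set where
    field
      symmetric    : ∀ a b → E a b ≡ E b a
      independent  : ∀ a b → E a b ≡ true → S a ≡ true → S b ≡ false
      even-outside : ∀ y → S y ≡ false → 2 ∣ degS E y
  open Balanced

  degS-del-row : ∀ E y x → E y x ≡ true → S x ≡ true → degS (del E y x) y + 1 ≡ degS E y
  degS-del-row E y x Eyx x∈S = card-remove (λ w → E y w ∧ S w) (λ w → del E y x y w ∧ S w) x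
    (cong₂ _∧_ Eyx x∈S) (cong (_∧ S x) (del-removes E y x)) (λ w w≢x → cong (_∧ S w) (del-row E y x w w≢x))

  degS-del-other : ∀ E u v y → y ≢ u → y ≢ v → degS (del E u v) y ≡ degS E y
  degS-del-other E u v y y≢u y≢v =
    card-cong (λ w → cong (_∧ S w) (del-keeps E u v y w (y≢u ∘ proj₁) (y≢v ∘ proj₁)))

  S-distinct : ∀ {a b} → S a ≡ true → S b ≡ false → a ≢ b
  S-distinct a∈S b∉S refl with trans (sym a∈S) b∉S
  ... | ()

  degS-alice : ∀ {E u v} → Balanced E → E u v ≡ true → S u ≡ true → degS (del E u v) v + 1 ≡ degS E v
  degS-alice {E} {u} {v} bal Euv u∈S =
    trans (cong (_+ 1) (card-cong (λ w → cong (_∧ S w) (del-comm E u v v w))))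
          (degS-del-row E v u (trans (symmetric bal v u) Euv) u∈S)

  -- Hence v has an odd S-degree afterwards, so Bob has a reply vw with w ∈ S.
  bob-reply : ∀ {E u v} → Balanced E → E u v ≡ true → S u ≡ true →
    Σ (Fin n) λ w → del E u v v w ≡ true × S w ≡ true
  bob-reply {E} {u} {v} bal Euv u∈S =
    let (w , E′vw∧w∈S) = card-witness (λ w → del E u v v w ∧ S w) (odd-nonzero _ odd) in w , ∧-true E′vw∧w∈S
    where
    odd : 2 ∣ degS (del E u v) v + 1
    odd = subst (2 ∣_) (sym (degS-alice bal Euv u∈S)) (even-outside bal v (independent bal u v Euv u∈S))

  balanced-round : ∀ {E u v w} → Balanced E → E u v ≡ true → S u ≡ true →
    del E u v v w ≡ true → S w ≡ true → Balanced (del (del E u v) v w)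
  balanced-round {E} {u} {v} {w} bal Euv u∈S E′vw w∈S = record
    { symmetric    = del-symmetric E′ v w (del-symmetric E u v (symmetric bal))
    ; independent  = λ a b E″ab → independent bal a b (del-⊆ E u v a b (del-⊆ E′ v w a b E″ab))
    ; even-outside = even
    }
    where
    E′ E″ : Edges n
    E′ = del E u v
    E″ = del E′ v w
    v∉S : S v ≡ false
    v∉S = independent bal u v Euv u∈S
    two-less : degS E″ v + 1 + 1 ≡ degS E v
    two-less = trans (cong (_+ 1) (degS-del-row E′ v w E′vw w∈S)) (degS-alice bal Euv u∈S)
    unchanged : ∀ y → S y ≡ false → y ≢ v → degS E″ y ≡ degS E y
    unchanged y y∉S y≢v = trans (degS-del-other E′ v w y y≢v (S-distinct w∈S y∉S ∘ sym))
                                (degS-del-other E u v y (S-distinct u∈S y∉S ∘ sym) y≢v)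
    even : ∀ y → S y ≡ false → 2 ∣ degS E″ y
    even y y∉S = by-cases (y ≟ v)
      where
      by-cases : Dec (y ≡ v) → 2 ∣ degS E″ y
      by-cases (yes refl) = even-minus-two (degS E″ v) (subst (2 ∣_) (sym two-less) (even-outside bal v v∉S))
      by-cases (no y≢v) = subst (2 ∣_) (sym (unchanged y y∉S y≢v)) (even-outside bal y y∉S)

  bob-wins : ∀ E u → Acc _<_ (size E) → Balanced E → S u ≡ true → Lose E u
  bob-wins E u (acc smaller) bal u∈S = lose alice-moves
    where
    alice-moves : ∀ v → E u v ≡ true → ¬ Ends (del E u v) v × Win (del E u v) v
    alice-moves v Euv with bob-reply bal Euv u∈S
    ... | w , E′vw , w∈S = alice-does-not-win , winLater w E′vw (bob-wins E″ w (smaller fewer) balanced w∈S)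
      where
      E′ E″ : Edges n
      E′ = del E u v
      E″ = del E′ v w
      v∉S : S v ≡ false
      v∉S = independent bal u v Euv u∈S
      alice-does-not-win : ¬ Ends E′ v
      alice-does-not-win (inj₁ v≡s) = S-distinct s∈S v∉S (sym v≡s)
      alice-does-not-win (inj₂ isolated) with trans (sym E′vw) (isolated w)
      ... | ()
      fewer : size E″ < size E
      fewer = <-≤-trans (size-del E′ v w E′vw) (<⇒≤ (size-del E u v Euv))
      balanced : Balanced E″
      balanced = balanced-round bal Euv u∈S E′vw w∈S

module LinkCounting {n : ℕ} {G : Graph n} (T : Triangulation G) where
  open Triangulation T

  faces-at : ∀ y a → card (face y a) ≡ 2 * ind (adj G y a)
  faces-at y a with adj G y a in ya
  ... | true = trans (sym (count≡card (face y a))) (edge-two y a ya)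
  ... | false = card-empty (face y a) no-face
    where
    no-face : ∀ b → face y a b ≡ false
    no-face b with face y a b in yab
    ... | false = refl
    ... | true with trans (sym (proj₁ (face-adj y a b yab))) ya
    ...   | ()

  -- Counting the faces y a b with Q a: each neighbour a with Q a contributes two.
  wedges : ∀ y (Q : Fin n → Bool) →
    ∑[ a < n ] card (λ b → face y a b ∧ Q a) ≡ 2 * card (λ a → adj G y a ∧ Q a)
  wedges y Q = trans (sum-cong-≗ per-neighbour) (sym (*-distribˡ-sum 2 (λ a → ind (adj G y a ∧ Q a))))
    where
    open ≡-Reasoning
    per-neighbour : ∀ a → card (λ b → face y a b ∧ Q a) ≡ 2 * ind (adj G y a ∧ Q a)
    per-neighbour a = begin
      card (λ b → face y a b ∧ Q a)      ≡⟨ card-∧-const (face y a) (Q a) ⟩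
      card (face y a) * ind (Q a)        ≡⟨ cong (_* ind (Q a)) (faces-at y a) ⟩
      2 * ind (adj G y a) * ind (Q a)    ≡⟨ *-assoc 2 (ind (adj G y a)) (ind (Q a)) ⟩
      2 * (ind (adj G y a) * ind (Q a))  ≡⟨ cong (2 *_) (sym (ind-∧ (adj G y a) (Q a))) ⟩
      2 * ind (adj G y a ∧ Q a)          ∎

  -- If every face y a b has exactly one of a, b in P, then y has as many
  -- neighbours in P as outside P; so its degree is twice the former number.
  degree-doubles : ∀ y (P : Fin n → Bool) → (∀ a b → face y a b ≡ true → P a ≡ not (P b)) →
    deg G y ≡ 2 * card (λ a → adj G y a ∧ P a)
  degree-doubles y P alternating = begin
    deg G y             ≡⟨ count≡card (adj G y) ⟩
    card (adj G y)      ≡⟨ card-split (adj G y) P ⟩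
    #in + #out          ≡⟨ cong (#in +_) (sym balanced) ⟩
    #in + #in           ≡⟨ cong (#in +_) (sym (+-identityʳ #in)) ⟩
    2 * #in             ∎
    where
    open ≡-Reasoning
    #in #out : ℕ
    #in = card (λ a → adj G y a ∧ P a)
    #out = card (λ a → adj G y a ∧ not (P a))
    one-corner : ∀ a b → face y a b ∧ P a ≡ face y a b ∧ not (P b)
    one-corner a b with face y a b in yab
    ... | false = refl
    ... | true = alternating a b yab
    balanced : #in ≡ #out
    balanced = *-cancelˡ-≡ #in #out 2 (begin
      2 * #in
        ≡⟨ sym (wedges y P) ⟩
      ∑[ a < n ] ∑[ b < n ] ind (face y a b ∧ P a)
        ≡⟨ sum-cong-≗ (λ a → sum-cong-≗ (λ b → cong ind (one-corner a b))) ⟩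
      ∑[ a < n ] ∑[ b < n ] ind (face y a b ∧ not (P b))
        ≡⟨ ∑-comm (λ a b → ind (face y a b ∧ not (P b))) ⟩
      ∑[ b < n ] ∑[ a < n ] ind (face y a b ∧ not (P b))
        ≡⟨ sum-cong-≗ (λ b → sum-cong-≗ (λ a → cong (λ t → ind (t ∧ not (P b))) (face-sym₂ y a b))) ⟩
      ∑[ b < n ] ∑[ a < n ] ind (face y b a ∧ not (P b))
        ≡⟨ wedges y (not ∘ P) ⟩
      2 * #out ∎)

open LinkCounting

fin2-cover : (k a b : Fin 2) → a ≢ b → k ≡ a ⊎ k ≡ b
fin2-cover zero zero _ _ = inj₁ refl
fin2-cover (suc zero) (suc zero) _ _ = inj₁ refl
fin2-cover zero (suc zero) zero _ = inj₂ refl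
fin2-cover (suc zero) zero (suc zero) _ = inj₂ refl
fin2-cover _ zero zero a≢b = ⊥-elim (a≢b refl)
fin2-cover _ (suc zero) (suc zero) a≢b = ⊥-elim (a≢b refl)

-- If x, a, b are three distinct colours out of three, every colour other than
-- x is a or b.  (Punching out x maps the remaining colours injectively to Fin 2.)
third-colour : ∀ {x a b k : Fin 3} → x ≢ a → x ≢ b → a ≢ b → x ≢ k → k ≡ a ⊎ k ≡ b
third-colour x≢a x≢b a≢b x≢k
  with fin2-cover (punchOut x≢k) (punchOut x≢a) (punchOut x≢b) (a≢b ∘ punchOut-injective x≢a x≢b)
... | inj₁ k≡a = inj₁ (punchOut-injective x≢k x≢a k≡a)
... | inj₂ k≡b = inj₂ (punchOut-injective x≢k x≢b k≡b)

module ColourClass {n : ℕ} {G : Graph n} (c : Fin n → Fin 3)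
  (proper : ∀ u v → adj G u v ≡ true → c u ≢ c v) (s : Fin n) where

  S : Fin n → Bool
  S w = ⌊ c w ≟ c s ⌋

  s∈S : S s ≡ true
  s∈S = yes⇒⌊⌋ (c s ≟ c s) refl

  one-corner-in-S : (T : Triangulation G) → ∀ y → S y ≡ false →
    ∀ a b → Triangulation.face T y a b ≡ true → S a ≡ not (S b)
  one-corner-in-S T y y∉S a b yab = by-cases (c a ≟ c s) (c b ≟ c s)
    where
    open Triangulation T
    y≢a : c y ≢ c a
    y≢a = proper y a (proj₁ (face-adj y a b yab))
    a≢b : c a ≢ c b
    a≢b = proper a b (proj₁ (proj₂ (face-adj y a b yab)))
    y≢b : c y ≢ c b
    y≢b = proper y b (proj₂ (proj₂ (face-adj y a b yab)))
    by-cases : (a? : Dec (c a ≡ c s)) (b? : Dec (c b ≡ c s)) → ⌊ a? ⌋ ≡ not ⌊ b? ⌋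
    by-cases (yes a∈S) (yes b∈S) = ⊥-elim (a≢b (trans a∈S (sym b∈S)))
    by-cases (yes _) (no _) = refl
    by-cases (no _) (yes _) = refl
    by-cases (no a∉S) (no b∉S) with third-colour y≢a y≢b a≢b (⌊⌋⇒no (c y ≟ c s) y∉S)
    ... | inj₁ s≡a = ⊥-elim (a∉S (sym s≡a))
    ... | inj₂ s≡b = ⊥-elim (b∉S (sym s≡b))

  open BalancedGame s S s∈S

  initially-balanced : Triangulation G → (∀ v → 4 ∣ deg G v) → Balanced (adj G)
  initially-balanced T 4∣deg = record
    { symmetric    = Graph.sym G
    ; independent  = λ a b ab a∈S →
        no⇒⌊⌋ (c b ≟ c s) (λ b∈S → proper a b ab (trans (⌊⌋⇒yes (c a ≟ c s) a∈S) (sym b∈S)))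
    ; even-outside = λ y y∉S →
        *-cancelˡ-∣ 2 (subst (4 ∣_) (degree-doubles T y S (one-corner-in-S T y y∉S)) (4∣deg y))
    }

-- Theorem 1.2.
theorem1p2 : (n : ℕ) (G : Graph n) → Triangulation G → ThreeChromatic G →
    Eulerian G → (∀ v → 4 ∣ deg G v) → (s : Fin n) → BobWins G s
theorem1p2 n G T ((c , proper) , _) _ 4∣deg s =
  bob-wins (adj G) s (<-wellFounded (size (adj G))) (initially-balanced T 4∣deg) s∈S
  where
  open ColourClass c proper s
  open BalancedGame s S s∈S
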